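{- Let $\mathcal C$ be a hereditary class of graphs with infinite VC-dimension and let $H$ be a bipartite graph. Then $\mathcal C$ contains a graph $G$ such that $H$ is a bipartisation of $G$.
   Context: A class of graphs is hereditary if it is closed under isomorphism and under taking induced subgraphs. The VC-dimension of a graph $G$ is the largest size of a set $X\subseteq V(G)$ such that for every $S\subseteq X$ some vertex $v$ satisfies $N[v]\cap X=S$ ($N[v]$ the closed neighbourhood); a class has infinite VC-dimension if these values are unbounded over the class. A bipartite graph $H=(A\cup B,E)$ is a bipartisation of a graph $G$ if there is a partition $A,B$ of $V(G)$ such that removing from $G$ all edges with both endpoints in $A$ and all edges with both endpoints in $B$ yields $H$. -}

module Defs where

open import Data.Nat using (ℕ; _≤_)
open import Data.Fin using (Fin; _≟_)
open import Data.Bool using (Bool; true; false; _∧_; _∨_; _xor_)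
open import Data.Product using (Σ; ∃; _×_; _,_)
open import Relation.Binary.PropositionalEquality using (_≡_)
open import Relation.Nullary using (does)
open import Function.Bundles using (_↔_; Inverse)
open import Function.Definitions using (Injective)
open import Level using (Level; suc)

record Graph : Set where
  field
    n      : ℕ
    adj    : Fin n → Fin n → Bool
    sym    : ∀ u v → adj u v ≡ adj v u
    irrefl : ∀ u → adj u u ≡ false

open Graph public

GraphClass : Set₁
GraphClass = Graph → Set

record _≅_ (G H : Graph) : Set where
  field
    bij      : Fin (n G) ↔ Fin (n H)
    preserve : ∀ u v → adj H (Inverse.to bij u) (Inverse.to bij v) ≡ adj G u v

-- Induced subgraph of G on the image of an injective map f : Fin m → Fin (n G)
-- (the subgraph induced by a vertex subset, relabelled by Fin m).
induced : (G : Graph) {m : ℕ} (f : Fin m → Fin (n G)) → Graph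
induced G {m} f = record
  { n = m
  ; adj = λ u v → adj G (f u) (f v)
  ; sym = λ u v → sym G (f u) (f v)
  ; irrefl = λ u → irrefl G (f u) }

Hereditary : GraphClass → Set
Hereditary C =
  (∀ G H → G ≅ H → C G → C H) ×
  (∀ G {m} (f : Fin m → Fin (n G)) → Injective _≡_ _≡_ f → C G → C (induced G f))

closedAdj : (G : Graph) → Fin (n G) → Fin (n G) → Bool
closedAdj G v u = does (v ≟ u) ∨ adj G v u

-- The set X = image of injective x : Fin k → V(G) (|X| = k) is shattered:
-- every subset S ⊆ X equals N[v] ∩ X for some vertex v.
Shattered : (G : Graph) {k : ℕ} → (Fin k → Fin (n G)) → Set
Shattered G {k} x =
  ∀ (S : Fin k → Bool) → ∃ λ (v : Fin (n G)) → ∀ i → closedAdj G v (x i) ≡ S i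

VCdimAtLeast : Graph → ℕ → Set
VCdimAtLeast G d =
  Σ ℕ λ k → d ≤ k × Σ (Fin k → Fin (n G)) λ x → Injective _≡_ _≡_ x × Shattered G x

InfiniteVCdim : GraphClass → Set
InfiniteVCdim C = ∀ d → ∃ λ G → C G × VCdimAtLeast G d

Bipartite : Graph → Set
Bipartite H = ∃ λ (c : Fin (n H) → Bool) → ∀ u v → adj H u v ≡ true → (c u xor c v) ≡ true

-- H is a bipartisation of G (up to identifying V(H) with V(G) via a bijection):
-- there is a partition A = {p = false}, B = {p = true} of V(G) such that deleting
-- all edges inside A and inside B yields H.
IsBipartisation : Graph → Graph → Set
IsBipartisation H G =
  Σ (Fin (n H) ↔ Fin (n G)) λ f → Σ (Fin (n G) → Bool) λ p →
    ∀ u v → adj H u v ≡ (adj G (Inverse.to f u) (Inverse.to f v) ∧ (p (Inverse.to f u) xor p (Inverse.to f v)))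

-- Colour H with sides L and R, let n = |V(H)|, and take an injective shattered set
-- X of size n(n+2) in some G ∈ C, viewed as n rows of n+2 cells. For u ∈ V(H) pick
-- b_u with N[b_u] ∩ X = {cell 0 of row u} ∪ (every cell of the rows of the
-- H-neighbours of u); the cells 0 make u ↦ b_u injective. By pigeonhole the n
-- vertices b_u miss one of the other n+1 cells of each row w; call it a_w. Since
-- a_w is no b_u, closed and open neighbourhoods agree there, so b_u ~ a_w in G
-- exactly when u ~ w in H. The subgraph induced on {b_u : u ∈ L} ∪ {a_w : w ∈ R}
-- lies in C, and deleting its edges inside L and inside R leaves H.
module Submission where

open import Defs
open import Data.Nat using (ℕ; suc; _*_)
open import Data.Nat.Properties using (<-irrefl; n<1+n)
open import Data.Fin using (Fin; zero; suc; toℕ; inject≤; combine; remQuot; _≟_)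
open import Data.Fin.Properties
  using (any?; ¬∀⟶∃¬; pigeonhole; suc-injective; inject≤-injective; combine-injective; remQuot-combine)
open import Data.Bool using (Bool; true; false; _∧_; _∨_; _xor_; if_then_else_)
open import Data.Bool.Properties using (∧-identityʳ; ∧-zeroʳ)
open import Data.Maybe using (Maybe; just; nothing)
open import Data.Product using (Σ; ∃; _×_; _,_; proj₁; proj₂)
open import Function using (_∘_)
open import Function.Definitions using (Injective)
open import Function.Construct.Identity using (↔-id)
open import Relation.Nullary using (¬_; yes; no; does; contradiction)
open import Relation.Nullary.Decidable using (dec-true; dec-false)
open import Relation.Binary.PropositionalEquality
  using (_≡_; _≢_; refl; trans; cong; subst; module ≡-Reasoning)
  renaming (sym to ≡-sym)

injective⇒partialInverse : ∀ {a b} {f : Fin a → Fin b} → Injective _≡_ _≡_ f →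
                           ∃ λ (r : Fin b → Maybe (Fin a)) → ∀ i → r (f i) ≡ just i
injective⇒partialInverse {f = f} f-inj = r , r∘f
  where
  r : Fin _ → Maybe (Fin _)
  r j with any? (λ i → f i ≟ j)
  ... | yes (i , _) = just i
  ... | no _        = nothing

  r∘f : ∀ i → r (f i) ≡ just i
  r∘f i with any? (λ i′ → f i′ ≟ f i)
  ... | yes (i′ , fi′≡fi) = cong just (f-inj fi′≡fi)
  ... | no ∄i′            = contradiction (i , refl) ∄i′

shattered-∘ : ∀ (G : Graph) {k a} {x : Fin k → Fin (n G)} {f : Fin a → Fin k} →
              Injective _≡_ _≡_ f → Shattered G x → Shattered G (x ∘ f)
shattered-∘ G {x = x} {f} f-inj shattered S with injective⇒partialInverse f-inj
... | r , r∘f = proj₁ realiser , λ i → trans (proj₂ realiser (f i)) (cong extend (r∘f i))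
  where
  extend : Maybe (Fin _) → Bool
  extend (just i) = S i
  extend nothing  = false

  realiser : ∃ λ v → ∀ j → closedAdj G v (x j) ≡ extend (r j)
  realiser = shattered (extend ∘ r)

vcdim⇒shatteredSet : ∀ G d → VCdimAtLeast G d →
                     Σ (Fin d → Fin (n G)) λ x → Injective _≡_ _≡_ x × Shattered G x
vcdim⇒shatteredSet G d (k , d≤k , x , x-inj , shattered) =
  x ∘ ι , ι-inj ∘ x-inj , shattered-∘ G ι-inj shattered
  where
  ι : Fin d → Fin k
  ι i = inject≤ i d≤k

  ι-inj : Injective _≡_ _≡_ ι
  ι-inj = inject≤-injective d≤k d≤k _ _

closedAdj-≢ : ∀ G {v u} → v ≢ u → closedAdj G v u ≡ adj G v u
closedAdj-≢ G {v} {u} v≢u = cong (_∨ adj G v u) (dec-false (v ≟ u) v≢u)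

∃-outside-image : ∀ {m p} (v : Fin m → Fin p) (y : Fin (suc m) → Fin p) →
                  Injective _≡_ _≡_ y → ∃ λ t → ∀ j → v j ≢ y t
∃-outside-image {m} v y y-inj with ¬∀⟶∃¬ (suc m) Hit (λ t → any? (λ j → v j ≟ y t)) notAllHit
  where
  Hit : Fin (suc m) → Set
  Hit t = ∃ λ j → v j ≡ y t

  notAllHit : ¬ (∀ t → Hit t)
  notAllHit hit with pigeonhole (n<1+n m) (proj₁ ∘ hit)
  ... | t₁ , t₂ , t₁<t₂ , same = <-irrefl (cong toℕ (y-inj yt₁≡yt₂)) t₁<t₂
    where
    yt₁≡yt₂ : y t₁ ≡ y t₂
    yt₁≡yt₂ = trans (≡-sym (proj₂ (hit t₁))) (trans (cong v same) (proj₂ (hit t₂)))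
... | t , missed = t , λ j vj≡yt → missed (j , vj≡yt)

record BiadjacencyEmbedding (G : Graph) {m : ℕ} (R : Fin m → Fin m → Bool) : Set where
  field
    left right      : Fin m → Fin (n G)
    left-injective  : Injective _≡_ _≡_ left
    right-injective : Injective _≡_ _≡_ right
    left≢right      : ∀ u w → left u ≢ right w
    adj-left-right  : ∀ u w → adj G (left u) (right w) ≡ R u w

shattered⇒biadjacencyEmbedding :
  ∀ G {m} (x : Fin (m * suc (suc m)) → Fin (n G)) → Injective _≡_ _≡_ x → Shattered G x →
  (R : Fin m → Fin m → Bool) → BiadjacencyEmbedding G R
shattered⇒biadjacencyEmbedding G {m} x x-inj shattered R = record
  { left            = b
  ; right           = a
  ; left-injective  = b-injective
  ; right-injective = λ {w} {w′} → proj₁ ∘ cell-injective w _ w′ _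
  ; left≢right      = b≢a
  ; adj-left-right  = λ u w → trans (≡-sym (closedAdj-≢ G (b≢a u w))) (b-trace u w _)
  }
  where
  open ≡-Reasoning

  cell : Fin m → Fin (suc (suc m)) → Fin (n G)
  cell i t = x (combine i t)

  cell-injective : ∀ i t i′ t′ → cell i t ≡ cell i′ t′ → i ≡ i′ × t ≡ t′
  cell-injective i t i′ t′ = combine-injective i t i′ t′ ∘ x-inj

  template : Fin m → Fin m × Fin (suc (suc m)) → Bool
  template u (i , zero)  = does (u ≟ i)
  template u (i , suc _) = R u i

  b : Fin m → Fin (n G)
  b u = proj₁ (shattered (template u ∘ remQuot _))

  b-trace : ∀ u i t → closedAdj G (b u) (cell i t) ≡ template u (i , t)
  b-trace u i t = trans (proj₂ (shattered (template u ∘ remQuot _)) (combine i t))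
                        (cong (template u) (remQuot-combine i t))

  b-injective : Injective _≡_ _≡_ b
  b-injective {u} {w} bu≡bw with u ≟ w
  ... | yes u≡w = u≡w
  ... | no u≢w  = contradiction true≡false λ ()
    where
    true≡false : true ≡ false
    true≡false = begin
      true                               ≡⟨ dec-true (u ≟ u) refl ⟨
      template u (u , zero)              ≡⟨ b-trace u u zero ⟨
      closedAdj G (b u) (cell u zero)    ≡⟨ cong (λ v → closedAdj G v (cell u zero)) bu≡bw ⟩
      closedAdj G (b w) (cell u zero)    ≡⟨ b-trace w u zero ⟩
      template w (u , zero)              ≡⟨ dec-false (w ≟ u) (u≢w ∘ ≡-sym) ⟩
      false                              ∎

  missedCell : ∀ w → ∃ λ t → ∀ u → b u ≢ cell w (suc t)
  missedCell w = ∃-outside-image b (cell w ∘ suc)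
    (λ {t} {t′} → suc-injective ∘ proj₂ ∘ cell-injective w (suc t) w (suc t′))

  a : Fin m → Fin (n G)
  a w = cell w (suc (proj₁ (missedCell w)))

  b≢a : ∀ u w → b u ≢ a w
  b≢a u w = proj₂ (missedCell w) u

ProperColouring : (H : Graph) → (Fin (n H) → Bool) → Set
ProperColouring H c = ∀ u v → adj H u v ≡ true → (c u xor c v) ≡ true

proper⇒monochromatic-nonadjacent : ∀ H {c} → ProperColouring H c →
                                   ∀ {u v} → c u ≡ c v → adj H u v ≡ false
proper⇒monochromatic-nonadjacent H {c} proper {u} {v} cu≡cv with adj H u v in uv
... | false = refl
... | true  = contradiction (subst (λ b → (b xor c v) ≡ true) cu≡cv (proper u v uv)) (xor-self (c v))
  where
  xor-self : ∀ b → (b xor b) ≢ true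
  xor-self true  ()
  xor-self false ()

induced-isBipartisation :
  ∀ G H (c : Fin (n H) → Bool) → ProperColouring H c → (g : Fin (n H) → Fin (n G)) →
  (∀ u w → c u ≡ true → c w ≡ false → adj G (g u) (g w) ≡ adj H u w) →
  IsBipartisation H (induced G g)
induced-isBipartisation G H c proper g cross = ↔-id _ , c , bipartised
  where
  monochromatic : ∀ {u w} → c u ≡ c w → adj H u w ≡ (adj G (g u) (g w) ∧ false)
  monochromatic cu≡cw =
    trans (proper⇒monochromatic-nonadjacent H proper cu≡cw) (≡-sym (∧-zeroʳ _))

  bipartised : ∀ u w → adj H u w ≡ (adj G (g u) (g w) ∧ (c u xor c w))
  bipartised u w with c u in cu | c w in cw
  ... | true  | true  = monochromatic (trans cu (≡-sym cw))
  ... | false | false = monochromatic (trans cu (≡-sym cw))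
  ... | true  | false = ≡-sym (trans (∧-identityʳ (adj G (g u) (g w))) (cross u w cu cw))
  ... | false | true  = ≡-sym (trans (∧-identityʳ (adj G (g u) (g w))) (begin
    adj G (g u) (g w)  ≡⟨ Graph.sym G (g u) (g w) ⟩
    adj G (g w) (g u)  ≡⟨ cross w u cw cu ⟩
    adj H w u          ≡⟨ Graph.sym H w u ⟩
    adj H u w          ∎))
    where open ≡-Reasoning

module _ {G : Graph} (H : Graph) (E : BiadjacencyEmbedding G (adj H)) (c : Fin (n H) → Bool) where
  open BiadjacencyEmbedding E

  colourSplit : Fin (n H) → Fin (n G)
  colourSplit u = if c u then left u else right u

  colourSplit-injective : Injective _≡_ _≡_ colourSplit
  colourSplit-injective {u} {w} e with c u | c w
  ... | true  | true  = left-injective e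
  ... | false | false = right-injective e
  ... | true  | false = contradiction e (left≢right u w)
  ... | false | true  = contradiction (≡-sym e) (left≢right w u)

  colourSplit-cross : ∀ u w → c u ≡ true → c w ≡ false →
                      adj G (colourSplit u) (colourSplit w) ≡ adj H u w
  colourSplit-cross u w cu cw rewrite cu | cw = adj-left-right u w

lemma3 : (C : GraphClass) → Hereditary C → InfiniteVCdim C →
         (H : Graph) → Bipartite H → ∃ λ G → C G × IsBipartisation H G
lemma3 C (_ , induced-closed) infinite H (c , proper)
  with infinite (n H * suc (suc (n H)))
... | G , G∈C , vcdim with vcdim⇒shatteredSet G _ vcdim
... | x , x-inj , shattered =
  induced G g , induced-closed G g (colourSplit-injective H E c) G∈C ,
  induced-isBipartisation G H c proper g (colourSplit-cross H E c)
  where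
  E : BiadjacencyEmbedding G (adj H)
  E = shattered⇒biadjacencyEmbedding G x x-inj shattered (adj H)

  g : Fin (n H) → Fin (n G)
  g = colourSplit H E c
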